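{- Let $p$ be a prime and let $x_1,\dots,x_n$ be positive integers with $\frac{1}{x_1}+\dots+\frac{1}{x_n}=1$, with $p$ dividing at least one $x_i$. Let $\alpha=\max_i v_p(x_i)$ and let $s$ be the number of indices $i$ with $v_p(x_i)=\alpha$. Let $t\geq 2$ and let $i_1,\dots,i_t$ be $t$ distinct indices with $v_p(x_{i_v})=\alpha$; write $x_{i_v}=p^{\alpha}x'_{i_v}$ with $p\nmid x'_{i_v}$. If $p\mid\sigma_{t-1}(x'_{i_1},\dots,x'_{i_t})$, then either $s=t$ or $s\geq t+2$.
   Context: $v_p$ is the $p$-adic valuation. $\sigma_k(a_1,\dots,a_m)=\sum_{1\leq j_1<\dots<j_k\leq m}a_{j_1}\cdots a_{j_k}$ is the $k$-th elementary symmetric function. -}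

module Defs where

open import Data.Nat using (ℕ; zero; suc; _+_; _*_; _⊔_)
open import Data.Nat.Divisibility using (_∣?_)
open import Data.Nat.DivMod using (_/_)
open import Data.Fin using (Fin)
open import Data.List using (List; []; _∷_; foldr; map; length; filter)
open import Data.List using (allFin)
open import Data.Integer using (+_)
import Data.Rational as ℚ
open ℚ using (ℚ)
open import Relation.Nullary using (yes; no)
open import Relation.Binary.PropositionalEquality using (_≡_)
open import Data.Nat.Properties using (_≟_)

-- p-adic valuation v_p(x), computed with fuel.  With fuel x it is exact for
-- p ≥ 2 and x ≥ 1 (since v_p(x) < x).  Conventions (irrelevant here):
-- v_p(0) = 0, and junk values for p ≤ 1.
vAux : ℕ → ℕ → ℕ → ℕ
vAux zero    p       x = 0
vAux (suc f) zero    x = 0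
vAux (suc f) (suc q) x with suc q ∣? x
... | yes _ = suc (vAux f (suc q) (x / suc q))
... | no  _ = 0

v : ℕ → ℕ → ℕ
v p x = vAux x p x

recip : ℕ → ℚ
recip zero    = ℚ.0ℚ
recip (suc k) = (+ 1) ℚ./ suc k

recipSum : (n : ℕ) → (Fin n → ℕ) → ℚ
recipSum n x = foldr ℚ._+_ ℚ.0ℚ (map (λ i → recip (x i)) (allFin n))

maxF : (n : ℕ) → (Fin n → ℕ) → ℕ
maxF n f = foldr _⊔_ 0 (map f (allFin n))

countEq : (n : ℕ) → (Fin n → ℕ) → ℕ → ℕ
countEq n f a = length (filter (λ i → f i ≟ a) (allFin n))

esym : ℕ → List ℕ → ℕ
esym zero    _        = 1
esym (suc k) []       = 0
esym (suc k) (a ∷ as) = a * esym k as + esym (suc k) as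

{-# OPTIONS --safe #-}

-- Write xᵢ = p^{Vᵢ} yᵢ with p ∤ yᵢ, let uᵢ be an inverse of yᵢ modulo p, and α = max Vᵢ ≥ 1.
-- Clearing denominators in ∑ 1/xᵢ = 1 gives ∑ᵢ p^{α−Vᵢ} ∏_{j≠i} yⱼ = p^α ∏ⱼ yⱼ; reducing modulo p
-- and multiplying by ∏ⱼ uⱼ leaves ∑_{Vᵢ=α} uᵢ ≡ 0. In the same way p ∣ σ_{t−1}(x′) gives
-- ∑ₖ u_{iₖ} ≡ 0, because x′ₖ = y_{iₖ}. Hence the uᵢ over the s − t indices of maximal valuation
-- outside {i₁,…,i_t} sum to 0 modulo p, which is impossible for a single index since no uᵢ
-- vanishes modulo p.

module Submission where

open import Defs
open import Data.Nat using (ℕ; suc; _+_; _*_; _^_; _≤_; _∸_)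
open import Data.Nat.Primality using (Prime)
open import Data.Nat.Divisibility using (_∣_)
open import Data.Fin using (Fin)
open import Data.Product using (∃)
open import Data.Sum using (_⊎_)
open import Data.Vec.Functional using (toList)
open import Function.Definitions using (Injective)
open import Relation.Nullary using (¬_)
open import Relation.Binary.PropositionalEquality using (_≡_)
import Data.Rational as ℚ

open import Data.Nat.Base using (zero; nonTrivial⇒n>1; nonTrivial⇒≢1; _<_; _⊔_; _%_; NonZero; z≤n; s≤s)
open import Data.Nat.Properties using (_≟_; +-*-semiring; *-1-commutativeMonoid; *-commutativeSemigroup; +-identityʳ; *-identityˡ; *-zeroʳ; +-comm; n∸n≡0; m<n⇒0<n∸m; ≤∧≢⇒<; m≤m⊔n; m≤n⊔m; m<n⇒m<1+n; *-comm; *-assoc; *-cancelˡ-≡; m*n≢0; m^n≢0; ^-distribˡ-+-*; *-identityʳ; *-distribʳ-+; m+[n∸m]≡n; +-monoʳ-≤; ≤-trans; ≤-reflexive; ≤-refl; ≤-pred; <-≤-trans; m<m*n; m+n≡0⇒m≡0; m+n≡0⇒n≡0; suc-injective)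
open import Data.Nat.Divisibility using (divides; _∣?_; ∣m+n∣m⇒∣n; _∣0; n∣m⇒m%n≡0; m%n≡0⇒n∣m; ∣m⇒∣m*n; ∣n⇒∣m*n; ∣1⇒≡1; m∣m*n)
open import Data.Nat.Primality using (prime⇒irreducible; prime⇒nonZero; prime⇒nonTrivial)
open import Data.Nat.Coprimality using (Coprime; coprime-Bézout)
open import Data.Nat.GCD using (module Bézout)
open import Data.Nat.DivMod using (_/_; m*n/n≡m; [m+kn]%n≡m%n; %-distribˡ-+; %-distribˡ-*)
open import Data.Nat.Tactic.RingSolver using (solve-∀)
open import Data.Bool.Base using (if_then_else_; true; false)
open import Data.Fin.Base using (zero; suc)
import Data.Fin.Properties as Finₚ
open import Data.Product using (_,_; _×_; proj₁; proj₂)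
open import Data.Sum using (inj₁; inj₂)
open import Data.Vec.Functional using (Vector)
open import Data.List.Base using (tabulate; allFin; length; filter)
import Data.List.Base as List
open import Data.List.Properties using (map-tabulate)
import Data.Vec.Functional as Vector
import Data.Integer.Base as ℤ
import Data.Integer.Properties as ℤₚ
import Data.Rational.Properties as ℚₚ
import Data.Rational.Unnormalised.Base as ℚᵘ
open ℚᵘ using (mkℚᵘ)
import Data.Rational.Unnormalised.Properties as ℚᵘₚ
open import Function.Base using (_∘_; id)
open import Relation.Nullary using (Dec; does; yes; no; contradiction)
open import Relation.Binary.PropositionalEquality using (_≢_; refl; sym; trans; cong; cong₂; subst; _≗_; module ≡-Reasoning)
open import Algebra.Properties.Semiring.Sum +-*-semiring using (sum-syntax; sum-cong-≗; ∑-distrib-+; ∑-comm; *-distribʳ-sum; sum-replicate-zero)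
open import Algebra.Properties.CommutativeSemigroup *-commutativeSemigroup using () renaming (interchange to *-interchange; x∙yz≈y∙xz to *-left-commute)
open import Algebra.Properties.CommutativeMonoid.Sum *-1-commutativeMonoid using () renaming (sum to product; sum-cong-≗ to product-cong-≗; ∑-distrib-+ to product-distrib-*)

𝟙 : ∀ {a} {A : Set a} → Dec A → ℕ
𝟙 a? = if does a? then 1 else 0

𝟙-yes : ∀ {a} {A : Set a} → A → (a? : Dec A) → 𝟙 a? ≡ 1
𝟙-yes a (yes _) = refl
𝟙-yes a (no ¬a) = contradiction a ¬a

𝟙-no : ∀ {a} {A : Set a} → ¬ A → (a? : Dec A) → 𝟙 a? ≡ 0
𝟙-no ¬a (yes a) = contradiction a ¬a
𝟙-no ¬a (no _)  = refl

∑-1≡n : ∀ n → ∑[ i < n ] 1 ≡ n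
∑-1≡n zero    = refl
∑-1≡n (suc n) = cong suc (∑-1≡n n)

∑-𝟙-*≡ : ∀ {n} (j : Fin n) (g : Fin n → ℕ) → ∑[ i < n ] (𝟙 (j Finₚ.≟ i) * g i) ≡ g j
∑-𝟙-*≡ {suc n} zero    g = trans (cong₂ _+_ (*-identityˡ (g zero)) (sum-replicate-zero n)) (+-identityʳ (g zero))
∑-𝟙-*≡ {suc n} (suc j) g = ∑-𝟙-*≡ j (g ∘ suc)

∑≡0⇒∑*≡0 : ∀ {n} (d g : Fin n → ℕ) → ∑[ i < n ] d i ≡ 0 → ∑[ i < n ] (d i * g i) ≡ 0
∑≡0⇒∑*≡0 {zero}  d g _ = refl
∑≡0⇒∑*≡0 {suc n} d g ∑d≡0 rewrite m+n≡0⇒m≡0 (d zero) ∑d≡0 =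
  ∑≡0⇒∑*≡0 (d ∘ suc) (g ∘ suc) (m+n≡0⇒n≡0 (d zero) ∑d≡0)

∑≡1⇒∑*≡point : ∀ {n} (d g : Fin n → ℕ) → ∑[ i < n ] d i ≡ 1 → ∃ λ j → ∑[ i < n ] (d i * g i) ≡ g j
∑≡1⇒∑*≡point {suc n} d g ∑d≡1 with d zero
... | 0 = let j , eq = ∑≡1⇒∑*≡point (d ∘ suc) (g ∘ suc) ∑d≡1 in suc j , eq
... | 1 = zero , trans (cong (1 * g zero +_) (∑≡0⇒∑*≡0 (d ∘ suc) (g ∘ suc) (suc-injective ∑d≡1)))
                   (trans (+-identityʳ _) (*-identityˡ (g zero)))
... | suc (suc _) with () ← ∑d≡1

-- Counting with an injection

multiplicity : ∀ {t n} → (Fin t → Fin n) → Fin n → ℕ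
multiplicity {t} ι i = ∑[ k < t ] 𝟙 (ι k Finₚ.≟ i)

∑-multiplicity-* : ∀ {t n} (ι : Fin t → Fin n) (g : Fin n → ℕ) →
                   ∑[ i < n ] (multiplicity ι i * g i) ≡ ∑[ k < t ] g (ι k)
∑-multiplicity-* {t} {n} ι g = begin
  ∑[ i < n ] (multiplicity ι i * g i)              ≡⟨ sum-cong-≗ (λ i → *-distribʳ-sum (g i) (λ k → 𝟙 (ι k Finₚ.≟ i))) ⟩
  ∑[ i < n ] ∑[ k < t ] (𝟙 (ι k Finₚ.≟ i) * g i)   ≡⟨ ∑-comm (λ i k → 𝟙 (ι k Finₚ.≟ i) * g i) ⟩
  ∑[ k < t ] ∑[ i < n ] (𝟙 (ι k Finₚ.≟ i) * g i)   ≡⟨ sum-cong-≗ (λ k → ∑-𝟙-*≡ (ι k) g) ⟩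
  ∑[ k < t ] g (ι k)                               ∎
  where open ≡-Reasoning

multiplicity-outside : ∀ {t n} (ι : Fin t → Fin n) {i} → (∀ k → ι k ≢ i) → multiplicity ι i ≡ 0
multiplicity-outside {t} ι i∉ι = trans (sum-cong-≗ (λ k → 𝟙-no (i∉ι k) (ι k Finₚ.≟ _))) (sum-replicate-zero t)

multiplicity-≤ : ∀ {t n} (ι : Fin t → Fin n) → Injective _≡_ _≡_ ι →
                 (b : Fin n → ℕ) → (∀ k → 1 ≤ b (ι k)) → ∀ i → multiplicity ι i ≤ b i
multiplicity-≤ {zero}  ι ι-inj b 1≤bι i = z≤n
multiplicity-≤ {suc t} ι ι-inj b 1≤bι i with ι zero Finₚ.≟ i
... | yes refl = ≤-trans (≤-reflexive (cong suc ι₀∉ιsuc)) (1≤bι zero)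
  where
  ι₀∉ιsuc : multiplicity (ι ∘ suc) (ι zero) ≡ 0
  ι₀∉ιsuc = multiplicity-outside (ι ∘ suc) (λ k eq → Finₚ.0≢1+n (ι-inj (sym eq)))
... | no _ = multiplicity-≤ (ι ∘ suc) (Finₚ.suc-injective ∘ ι-inj) b (1≤bι ∘ suc) i

∑-*-split : ∀ {n} (c b : Fin n → ℕ) → (∀ i → c i ≤ b i) → (g : Fin n → ℕ) →
            ∑[ i < n ] (b i * g i) ≡ ∑[ i < n ] (c i * g i) + ∑[ i < n ] ((b i ∸ c i) * g i)
∑-*-split c b c≤b g = trans (sum-cong-≗ split) (∑-distrib-+ (λ i → c i * g i) (λ i → (b i ∸ c i) * g i))
  where
  split : ∀ i → b i * g i ≡ c i * g i + (b i ∸ c i) * g i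
  split i = trans (cong (_* g i) (sym (m+[n∸m]≡n (c≤b i)))) (*-distribʳ-+ (g i) (c i) (b i ∸ c i))

t+e≡t⊎t+2≤t+e : ∀ t e → e ≢ 1 → t + e ≡ t ⊎ t + 2 ≤ t + e
t+e≡t⊎t+2≤t+e t 0             _   = inj₁ (+-identityʳ t)
t+e≡t⊎t+2≤t+e t 1             e≢1 = contradiction refl e≢1
t+e≡t⊎t+2≤t+e t (suc (suc e)) _   = inj₂ (+-monoʳ-≤ t (s≤s (s≤s z≤n)))

-- Off the image of ι the weights b leave a mass ∑ d = ∑ b − t; were it 1, it would sit at
-- a single index j and force P ∣ g j.
∑≡t⊎t+2≤∑ : ∀ {P t n} (ι : Fin t → Fin n) → Injective _≡_ _≡_ ι →
            (b g : Fin n → ℕ) → (∀ k → 1 ≤ b (ι k)) → (∀ i → ¬ P ∣ g i) →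
            P ∣ ∑[ i < n ] (b i * g i) → P ∣ ∑[ k < t ] g (ι k) →
            ∑[ i < n ] b i ≡ t ⊎ t + 2 ≤ ∑[ i < n ] b i
∑≡t⊎t+2≤∑ {P} {t} {n} ι ι-inj b g 1≤bι P∤g P∣∑bg P∣∑gι =
  subst (λ s → s ≡ t ⊎ t + 2 ≤ s) (sym ∑b≡t+∑d) (t+e≡t⊎t+2≤t+e t (∑[ i < n ] d i) ∑d≢1)
  where
  d : Fin n → ℕ
  d i = b i ∸ multiplicity ι i

  split : ∀ h → ∑[ i < n ] (b i * h i) ≡ ∑[ k < t ] h (ι k) + ∑[ i < n ] (d i * h i)
  split h = trans (∑-*-split (multiplicity ι) b (multiplicity-≤ ι ι-inj b 1≤bι) h)
                  (cong (_+ ∑[ i < n ] (d i * h i)) (∑-multiplicity-* ι h))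

  ∑b≡t+∑d : ∑[ i < n ] b i ≡ t + ∑[ i < n ] d i
  ∑b≡t+∑d = trans (sum-cong-≗ (sym ∘ *-identityʳ ∘ b))
                  (trans (split (λ _ → 1)) (cong₂ _+_ (∑-1≡n t) (sum-cong-≗ (*-identityʳ ∘ d))))

  ∑d≢1 : ∑[ i < n ] d i ≢ 1
  ∑d≢1 ∑d≡1 with j , ∑dg≡gj ← ∑≡1⇒∑*≡point d g ∑d≡1 =
    P∤g j (subst (P ∣_) ∑dg≡gj (∣m+n∣m⇒∣n (subst (P ∣_) (split g) P∣∑bg) P∣∑gι))

-- Cofactor sums

-- cofactorSum w y = ∑ᵢ wᵢ ∏_{j ≠ i} yⱼ
cofactorSum : ∀ {n} → Vector ℕ n → Vector ℕ n → ℕ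
cofactorSum {zero}  w y = 0
cofactorSum {suc n} w y = w zero * product (y ∘ suc) + y zero * cofactorSum (w ∘ suc) (y ∘ suc)

cofactorSum-cong : ∀ {n} {w w′ y y′ : Vector ℕ n} → w ≗ w′ → y ≗ y′ → cofactorSum w y ≡ cofactorSum w′ y′
cofactorSum-cong {zero}  w≗w′ y≗y′ = refl
cofactorSum-cong {suc n} w≗w′ y≗y′ =
  cong₂ _+_ (cong₂ _*_ (w≗w′ zero) (product-cong-≗ (y≗y′ ∘ suc)))
            (cong₂ _*_ (y≗y′ zero) (cofactorSum-cong (w≗w′ ∘ suc) (y≗y′ ∘ suc)))

*-cofactorSum : ∀ {n} c (w y : Vector ℕ n) → c * cofactorSum w y ≡ cofactorSum (λ i → c * w i) y
*-cofactorSum {zero}  c w y = *-zeroʳ c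
*-cofactorSum {suc n} c w y = begin
  c * (w zero * Y + y zero * C)          ≡⟨ distribute c (w zero) Y (y zero) C ⟩
  c * w zero * Y + y zero * (c * C)      ≡⟨ cong (λ z → c * w zero * Y + y zero * z) (*-cofactorSum c (w ∘ suc) (y ∘ suc)) ⟩
  c * w zero * Y + y zero * cofactorSum (λ i → c * w (suc i)) (y ∘ suc) ∎
  where
  open ≡-Reasoning
  Y C : ℕ
  Y = product (y ∘ suc)
  C = cofactorSum (w ∘ suc) (y ∘ suc)
  distribute : ∀ c w Y y C → c * (w * Y + y * C) ≡ c * w * Y + y * (c * C)
  distribute = solve-∀

cofactorSum-scale : ∀ {n} (a w y : Vector ℕ n) →
                    cofactorSum (λ i → a i * w i) (λ i → a i * y i) ≡ product a * cofactorSum w y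
cofactorSum-scale {zero}  a w y = sym (*-zeroʳ 1)
cofactorSum-scale {suc n} a w y = begin
  a₀ * w zero * product ay′ + a₀ * y zero * cofactorSum aw′ ay′
    ≡⟨ cong₂ (λ Π C → a₀ * w zero * Π + a₀ * y zero * C) (product-distrib-* (a ∘ suc) (y ∘ suc))
                                                        (cofactorSum-scale (a ∘ suc) (w ∘ suc) (y ∘ suc)) ⟩
  a₀ * w zero * (A * Y) + a₀ * y zero * (A * C)
    ≡⟨ factor a₀ (w zero) (y zero) A Y C ⟩
  a₀ * A * (w zero * Y + y zero * C) ∎
  where
  open ≡-Reasoning
  a₀ A Y C : ℕ
  a₀ = a zero
  A = product (a ∘ suc)
  Y = product (y ∘ suc)
  C = cofactorSum (w ∘ suc) (y ∘ suc)
  aw′ ay′ : Vector ℕ n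
  aw′ i = a (suc i) * w (suc i)
  ay′ i = a (suc i) * y (suc i)
  factor : ∀ a w y A Y C → a * w * (A * Y) + a * y * (A * C) ≡ a * A * (w * Y + y * C)
  factor = solve-∀

product-nonZero : ∀ {n} (a : Vector ℕ n) → (∀ i → NonZero (a i)) → NonZero (product a)
product-nonZero {zero}  a a≢0 = _
product-nonZero {suc n} a a≢0 =
  m*n≢0 (a zero) (product (a ∘ suc)) {{a≢0 zero}} {{product-nonZero (a ∘ suc) (a≢0 ∘ suc)}}

cofactorSum-strip-powers : ∀ {n} P .{{_ : NonZero P}} α (x y V : Vector ℕ n) →
                           (∀ i → x i ≡ P ^ V i * y i) → (∀ i → V i ≤ α) →
                           cofactorSum (λ _ → 1) x ≡ product x →
                           cofactorSum (λ i → P ^ (α ∸ V i)) y ≡ P ^ α * product y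
cofactorSum-strip-powers P α x y V x≡PᵛY V≤α cofactorSum≡product =
  *-cancelˡ-≡ _ _ (product a) {{product-nonZero a (λ i → m^n≢0 P (V i))}} (begin
    product a * cofactorSum w y                       ≡⟨ cofactorSum-scale a w y ⟨
    cofactorSum (λ i → a i * w i) (λ i → a i * y i)  ≡⟨ cofactorSum-cong aw≡Pᵅ*1 (sym ∘ x≡PᵛY) ⟩
    cofactorSum (λ _ → P ^ α * 1) x                   ≡⟨ *-cofactorSum (P ^ α) (λ _ → 1) x ⟨
    P ^ α * cofactorSum (λ _ → 1) x                   ≡⟨ cong (P ^ α *_) cofactorSum≡product ⟩
    P ^ α * product x                                 ≡⟨ cong (P ^ α *_) (product-cong-≗ x≡PᵛY) ⟩
    P ^ α * product (λ i → a i * y i)                 ≡⟨ cong (P ^ α *_) (product-distrib-* a y) ⟩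
    P ^ α * (product a * product y)                   ≡⟨ *-left-commute (P ^ α) (product a) (product y) ⟩
    product a * (P ^ α * product y)                   ∎)
  where
  open ≡-Reasoning
  a w : Vector ℕ _
  a i = P ^ V i
  w i = P ^ (α ∸ V i)
  aw≡Pᵅ*1 : ∀ i → a i * w i ≡ P ^ α * 1
  aw≡Pᵅ*1 i = begin
    P ^ V i * P ^ (α ∸ V i)  ≡⟨ ^-distribˡ-+-* P (V i) (α ∸ V i) ⟨
    P ^ (V i + (α ∸ V i))    ≡⟨ cong (P ^_) (m+[n∸m]≡n (V≤α i)) ⟩
    P ^ α                    ≡⟨ *-identityʳ (P ^ α) ⟨
    P ^ α * 1                ∎

esym-tabulate-short : ∀ k {m} (g : Vector ℕ m) → m < k → esym k (tabulate g) ≡ 0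
esym-tabulate-short (suc k) {zero}  g _         = refl
esym-tabulate-short (suc k) {suc m} g (s≤s m<k) =
  trans (cong₂ (λ a b → g zero * a + b) (esym-tabulate-short k (g ∘ suc) m<k)
                                        (esym-tabulate-short (suc k) (g ∘ suc) (m<n⇒m<1+n m<k)))
        (trans (+-identityʳ (g zero * 0)) (*-zeroʳ (g zero)))

esym-tabulate-product : ∀ {m} (g : Vector ℕ m) → esym m (tabulate g) ≡ product g
esym-tabulate-product {zero}  g = refl
esym-tabulate-product {suc m} g =
  trans (cong₂ (λ a b → g zero * a + b) (esym-tabulate-product (g ∘ suc)) (esym-tabulate-short (suc m) (g ∘ suc) ≤-refl))
        (+-identityʳ (g zero * product (g ∘ suc)))

esym-tabulate-cofactorSum : ∀ t (g : Vector ℕ (suc t)) → esym t (tabulate g) ≡ cofactorSum (λ _ → 1) g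
esym-tabulate-cofactorSum zero    g = cong suc (sym (*-zeroʳ (g zero)))
esym-tabulate-cofactorSum (suc t) g = begin
  g zero * esym t (tabulate (g ∘ suc)) + esym (suc t) (tabulate (g ∘ suc))
    ≡⟨ cong₂ (λ a b → g zero * a + b) (esym-tabulate-cofactorSum t (g ∘ suc)) (esym-tabulate-product (g ∘ suc)) ⟩
  g zero * C + product (g ∘ suc)      ≡⟨ +-comm (g zero * C) (product (g ∘ suc)) ⟩
  product (g ∘ suc) + g zero * C      ≡⟨ cong (_+ g zero * C) (*-identityˡ (product (g ∘ suc))) ⟨
  1 * product (g ∘ suc) + g zero * C  ∎
  where
  open ≡-Reasoning
  C : ℕ
  C = cofactorSum (λ _ → 1) (g ∘ suc)

foldr-tabulate : ∀ {A B : Set} (f : A → B → B) (z : B) {n} (g : Vector A n) →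
                 List.foldr f z (tabulate g) ≡ Vector.foldr f z g
foldr-tabulate f z {zero}  g = refl
foldr-tabulate f z {suc n} g = cong (f (g zero)) (foldr-tabulate f z (g ∘ suc))

foldr-map-allFin : ∀ {A B : Set} (f : A → B → B) (z : B) {n} (g : Vector A n) →
                   List.foldr f z (List.map g (allFin n)) ≡ Vector.foldr f z g
foldr-map-allFin f z {n} g = trans (cong (List.foldr f z) (map-tabulate id g)) (foldr-tabulate f z g)

≤-foldr-⊔ : ∀ {n} (f : Vector ℕ n) i → f i ≤ Vector.foldr _⊔_ 0 f
≤-foldr-⊔ f zero    = m≤m⊔n (f zero) _
≤-foldr-⊔ f (suc i) = ≤-trans (≤-foldr-⊔ (f ∘ suc) i) (m≤n⊔m (f zero) _)

≤-maxF : ∀ n (f : Vector ℕ n) i → f i ≤ maxF n f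
≤-maxF n f i = subst (f i ≤_) (sym (foldr-map-allFin _⊔_ 0 f)) (≤-foldr-⊔ f i)

length-filter-tabulate : ∀ {a p} {A : Set a} {P : A → Set p} (P? : ∀ x → Dec (P x)) {n} (g : Vector A n) →
                         length (filter P? (tabulate g)) ≡ ∑[ i < n ] 𝟙 (P? (g i))
length-filter-tabulate P? {zero}  g = refl
length-filter-tabulate P? {suc n} g with does (P? (g zero))
... | true  = cong suc (length-filter-tabulate P? (g ∘ suc))
... | false = length-filter-tabulate P? (g ∘ suc)

countEq-∑ : ∀ n (f : Vector ℕ n) a → countEq n f a ≡ ∑[ i < n ] 𝟙 (f i ≟ a)
countEq-∑ n f a = length-filter-tabulate (λ i → f i ≟ a) id

ℚᵘ-+-numerator : ∀ k m N → ℤ.+ 1 ℤ.* ℤ.+ suc m ℤ.+ ℤ.+ N ℤ.* ℤ.+ suc k ≡ ℤ.+ (1 * suc m + suc k * N)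
ℚᵘ-+-numerator k m N = begin
  ℤ.+ 1 ℤ.* ℤ.+ suc m ℤ.+ ℤ.+ N ℤ.* ℤ.+ suc k  ≡⟨ cong₂ ℤ._+_ (ℤₚ.pos-* 1 (suc m)) (ℤₚ.pos-* N (suc k)) ⟨
  ℤ.+ (1 * suc m) ℤ.+ ℤ.+ (N * suc k)          ≡⟨ ℤₚ.pos-+ (1 * suc m) (N * suc k) ⟨
  ℤ.+ (1 * suc m + N * suc k)                  ≡⟨ cong (λ z → ℤ.+ (1 * suc m + z)) (*-comm N (suc k)) ⟩
  ℤ.+ (1 * suc m + suc k * N)                  ∎
  where open ≡-Reasoning

recipSum-fraction : ∀ {n} (x : Vector ℕ n) → (∀ i → 1 ≤ x i) →
                    ∃ λ m → product x ≡ suc m ×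
                            ℚ.toℚᵘ (Vector.foldr ℚ._+_ ℚ.0ℚ (recip ∘ x)) ℚᵘ.≃ ℤ.+ cofactorSum (λ _ → 1) x ℚᵘ./ suc m
recipSum-fraction {zero}  x 1≤x = 0 , refl , ℚᵘₚ.≃-refl
recipSum-fraction {suc n} x 1≤x with x zero | 1≤x zero | recipSum-fraction (x ∘ suc) (1≤x ∘ suc)
... | suc k | _ | m , product≡1+m , ∑≃N/[1+m] =
  m + k * suc m , cong (suc k *_) product≡1+m , (begin
    ℚ.toℚᵘ (recip (suc k) ℚ.+ R)
      ≈⟨ ℚₚ.toℚᵘ-homo-+ (recip (suc k)) R ⟩
    ℚ.toℚᵘ (recip (suc k)) ℚᵘ.+ ℚ.toℚᵘ R
      ≈⟨ ℚᵘₚ.+-cong (ℚₚ.toℚᵘ-fromℚᵘ (ℤ.+ 1 ℚᵘ./ suc k)) ∑≃N/[1+m] ⟩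
    ℤ.+ 1 ℚᵘ./ suc k ℚᵘ.+ ℤ.+ N ℚᵘ./ suc m
      ≡⟨ cong (λ z → mkℚᵘ z (m + k * suc m)) (ℚᵘ-+-numerator k m N) ⟩
    mkℚᵘ (ℤ.+ (1 * suc m + suc k * N)) (m + k * suc m)
      ≡⟨ cong (λ z → mkℚᵘ (ℤ.+ (1 * z + suc k * N)) (m + k * suc m)) product≡1+m ⟨
    mkℚᵘ (ℤ.+ (1 * product (x ∘ suc) + suc k * N)) (m + k * suc m) ∎)
  where
  open ℚᵘₚ.≃-Reasoning
  R : ℚ.ℚ
  R = Vector.foldr ℚ._+_ ℚ.0ℚ (recip ∘ x ∘ suc)
  N : ℕ
  N = cofactorSum (λ _ → 1) (x ∘ suc)

recipSum≡1⇒cofactorSum≡product : ∀ n (x : Vector ℕ n) → (∀ i → 1 ≤ x i) → recipSum n x ≡ ℚ.1ℚ →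
                                 cofactorSum (λ _ → 1) x ≡ product x
recipSum≡1⇒cofactorSum≡product n x 1≤x recipSum≡1 with recipSum-fraction x 1≤x
... | m , product≡1+m , ∑≃N/[1+m] =
  trans (ℤₚ.+-injective (trans (sym (ℤₚ.*-identityʳ _)) (trans (ℚᵘₚ.drop-*≡* N/[1+m]≃1) (ℤₚ.*-identityˡ _))))
        (sym product≡1+m)
  where
  N/[1+m]≃1 : ℤ.+ cofactorSum (λ _ → 1) x ℚᵘ./ suc m ℚᵘ.≃ ℚᵘ.1ℚᵘ
  N/[1+m]≃1 = ℚᵘₚ.≃-trans (ℚᵘₚ.≃-sym ∑≃N/[1+m])
                (ℚᵘₚ.≃-reflexive (cong ℚ.toℚᵘ (trans (sym (foldr-map-allFin ℚ._+_ ℚ.0ℚ (recip ∘ x))) recipSum≡1)))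

vAux-split : ∀ {P} → 1 < P → ∀ fuel x → 1 ≤ x → x ≤ fuel → ∃ λ y → x ≡ P ^ vAux fuel P x * y × ¬ P ∣ y
vAux-split         1<P zero    x 1≤x x≤0 = contradiction (≤-trans 1≤x x≤0) λ ()
vAux-split {suc q} 1<P (suc f) x 1≤x x≤1+f with suc q ∣? x
... | no P∤x = x , sym (*-identityˡ x) , P∤x
... | yes (divides zero x≡0) = contradiction (≤-trans 1≤x (≤-reflexive x≡0)) λ ()
... | yes (divides c@(suc _) x≡cP) with vAux-split 1<P f c (s≤s z≤n) c≤f
  where
  c≤f : c ≤ f
  c≤f = ≤-pred (<-≤-trans (m<m*n c (suc q) 1<P) (≤-trans (≤-reflexive (sym x≡cP)) x≤1+f))
...   | y , c≡Pᵛy , P∤y = y , x≡PPᵛy , P∤y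
  where
  open ≡-Reasoning
  P : ℕ
  P = suc q
  x≡PPᵛy : x ≡ P * P ^ vAux f P (x / P) * y
  x≡PPᵛy = begin
    x                                ≡⟨ x≡cP ⟩
    c * P                            ≡⟨ cong (_* P) c≡Pᵛy ⟩
    P ^ vAux f P c * y * P           ≡⟨ rotate (P ^ vAux f P c) y P ⟩
    P * P ^ vAux f P c * y           ≡⟨ cong (λ m → P * P ^ vAux f P m * y) (m*n/n≡m c P) ⟨
    P * P ^ vAux f P (c * P / P) * y ≡⟨ cong (λ m → P * P ^ vAux f P (m / P) * y) x≡cP ⟨
    P * P ^ vAux f P (x / P) * y     ∎
    where
    rotate : ∀ a b c → a * b * c ≡ c * a * b
    rotate = solve-∀

v-split : ∀ {P x} → 1 < P → 1 ≤ x → ∃ λ y → x ≡ P ^ v P x * y × ¬ P ∣ y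
v-split {x = x} 1<P 1≤x = vAux-split 1<P x x 1≤x ≤-refl

∣⇒1≤v : ∀ {P x} → 1 < P → 1 ≤ x → P ∣ x → 1 ≤ v P x
∣⇒1≤v {P} {x} 1<P 1≤x P∣x with v P x | v-split {P} {x} 1<P 1≤x
... | zero  | y , x≡1*y , P∤y = contradiction (subst (P ∣_) (trans x≡1*y (*-identityˡ y)) P∣x) P∤y
... | suc _ | _               = s≤s z≤n

m∣m^n : ∀ m {n} → 1 ≤ n → m ∣ m ^ n
m∣m^n m {suc n} _ = m∣m*n (m ^ n)

-- Congruences modulo P

module Modular (P : ℕ) .{{_ : NonZero P}} where

  infix 4 _≋_
  _≋_ : ℕ → ℕ → Set
  a ≋ b = a % P ≡ b % P

  ≋-by-multiples : ∀ {a b} k l → a + k * P ≡ b + l * P → a ≋ b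
  ≋-by-multiples {a} {b} k l eq = trans (sym ([m+kn]%n≡m%n a k P)) (trans (cong (_% P) eq) ([m+kn]%n≡m%n b l P))

  ∣⇒≋0 : ∀ {a} → P ∣ a → a ≋ 0
  ∣⇒≋0 {a} P∣a = trans (n∣m⇒m%n≡0 a P P∣a) (sym (n∣m⇒m%n≡0 0 P (P ∣0)))

  ≋0⇒∣ : ∀ {a} → a ≋ 0 → P ∣ a
  ≋0⇒∣ {a} a≋0 = m%n≡0⇒n∣m a P (trans a≋0 (n∣m⇒m%n≡0 0 P (P ∣0)))

  +-cong-≋ : ∀ {a b c d} → a ≋ b → c ≋ d → a + c ≋ b + d
  +-cong-≋ {a} {b} {c} {d} a≋b c≋d = begin
    (a + c) % P             ≡⟨ %-distribˡ-+ a c P ⟩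
    (a % P + c % P) % P     ≡⟨ cong₂ (λ x y → (x + y) % P) a≋b c≋d ⟩
    (b % P + d % P) % P     ≡⟨ %-distribˡ-+ b d P ⟨
    (b + d) % P             ∎
    where open ≡-Reasoning

  *-cong-≋ : ∀ {a b c d} → a ≋ b → c ≋ d → a * c ≋ b * d
  *-cong-≋ {a} {b} {c} {d} a≋b c≋d = begin
    (a * c) % P             ≡⟨ %-distribˡ-* a c P ⟩
    (a % P * (c % P)) % P   ≡⟨ cong₂ (λ x y → (x * y) % P) a≋b c≋d ⟩
    (b % P * (d % P)) % P   ≡⟨ %-distribˡ-* b d P ⟨
    (b * d) % P             ∎
    where open ≡-Reasoning

  cofactorSum-cong-≋ : ∀ {n} {w w′ : Vector ℕ n} (y : Vector ℕ n) → (∀ i → w i ≋ w′ i) →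
                       cofactorSum w y ≋ cofactorSum w′ y
  cofactorSum-cong-≋ {zero}  y w≋w′ = refl
  cofactorSum-cong-≋ {suc n} y w≋w′ =
    +-cong-≋ (*-cong-≋ (w≋w′ zero) refl) (*-cong-≋ {y zero} refl (cofactorSum-cong-≋ (y ∘ suc) (w≋w′ ∘ suc)))

  product-*-inverses : ∀ {n} (y u : Vector ℕ n) → (∀ i → y i * u i ≋ 1) → product y * product u ≋ 1
  product-*-inverses {zero}  y u yu≋1 = refl
  product-*-inverses {suc n} y u yu≋1 =
    trans (cong (_% P) (*-interchange (y zero) (product (y ∘ suc)) (u zero) (product (u ∘ suc))))
          (*-cong-≋ (yu≋1 zero) (product-*-inverses (y ∘ suc) (u ∘ suc) (yu≋1 ∘ suc)))

  cofactorSum-*-inverses : ∀ {n} (w y u : Vector ℕ n) → (∀ i → y i * u i ≋ 1) →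
                           cofactorSum w y * product u ≋ ∑[ i < n ] (w i * u i)
  cofactorSum-*-inverses {zero}  w y u yu≋1 = refl
  cofactorSum-*-inverses {suc n} w y u yu≋1 = begin
    (w zero * Y + y zero * C) * (u zero * U) % P
      ≡⟨ cong (_% P) (expand (w zero) Y (y zero) C (u zero) U) ⟩
    (w zero * u zero * (Y * U) + y zero * u zero * (C * U)) % P
      ≡⟨ +-cong-≋ (*-cong-≋ {w zero * u zero} refl (product-*-inverses (y ∘ suc) (u ∘ suc) (yu≋1 ∘ suc)))
                  (*-cong-≋ (yu≋1 zero) (cofactorSum-*-inverses (w ∘ suc) (y ∘ suc) (u ∘ suc) (yu≋1 ∘ suc))) ⟩
    (w zero * u zero * 1 + 1 * ∑[ i < n ] (w (suc i) * u (suc i))) % P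
      ≡⟨ cong₂ (λ a b → (a + b) % P) (*-identityʳ (w zero * u zero)) (*-identityˡ _) ⟩
    (w zero * u zero + ∑[ i < n ] (w (suc i) * u (suc i))) % P ∎
    where
    open ≡-Reasoning
    Y U C : ℕ
    Y = product (y ∘ suc)
    U = product (u ∘ suc)
    C = cofactorSum (w ∘ suc) (y ∘ suc)
    expand : ∀ w Y y C u U → (w * Y + y * C) * (u * U) ≡ w * u * (Y * U) + y * u * (C * U)
    expand = solve-∀

  ∣cofactorSum⇒∣∑ : ∀ {n} (w y u : Vector ℕ n) → (∀ i → y i * u i ≋ 1) →
                    P ∣ cofactorSum w y → P ∣ ∑[ i < n ] (w i * u i)
  ∣cofactorSum⇒∣∑ w y u yu≋1 P∣C =
    ≋0⇒∣ (trans (sym (cofactorSum-*-inverses w y u yu≋1)) (∣⇒≋0 (∣m⇒∣m*n _ P∣C)))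

  prime∤⇒coprime : ∀ {y} → Prime P → ¬ P ∣ y → Coprime y P
  prime∤⇒coprime P-prime P∤y (d∣y , d∣P) with prime⇒irreducible P-prime d∣P
  ... | inj₁ d≡1  = d≡1
  ... | inj₂ refl = contradiction d∣y P∤y

  inverse : ∀ {y} → Prime P → ¬ P ∣ y → ∃ λ u → y * u ≋ 1
  inverse {y} P-prime P∤y with coprime-Bézout (prime∤⇒coprime P-prime P∤y)
  ... | Bézout.+- x z 1+zP≡xy = x , ≋-by-multiples 0 z (trans (+-identityʳ (y * x)) (trans (*-comm y x) (sym 1+zP≡xy)))
  ... | Bézout.-+ x z 1+xy≡zP = x * (x * y) , ≋-by-multiples z (x * y * z) (begin
    y * (x * (x * y)) + z * P        ≡⟨ cong (y * (x * (x * y)) +_) 1+xy≡zP ⟨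
    y * (x * (x * y)) + (1 + x * y)  ≡⟨ square x y ⟩
    1 + x * y * (1 + x * y)          ≡⟨ cong (λ m → 1 + x * y * m) 1+xy≡zP ⟩
    1 + x * y * (z * P)              ≡⟨ cong (1 +_) (*-assoc (x * y) z P) ⟨
    1 + x * y * z * P                ∎)
    where
    open ≡-Reasoning
    -- x y ≡ -1, hence (x y)² ≡ 1
    square : ∀ x y → y * (x * (x * y)) + (1 + x * y) ≡ 1 + x * y * (1 + x * y)
    square = solve-∀

  inverse-∤ : ∀ {y u} → P ≢ 1 → y * u ≋ 1 → ¬ P ∣ u
  inverse-∤ {y} P≢1 yu≋1 P∣u = P≢1 (∣1⇒≡1 (≋0⇒∣ (trans (sym yu≋1) (∣⇒≋0 (∣n⇒∣m*n y P∣u)))))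

  pow-∸≋𝟙 : ∀ α β → β ≤ α → P ^ (α ∸ β) ≋ 𝟙 (β ≟ α)
  pow-∸≋𝟙 α β β≤α with β ≟ α
  ... | yes refl = trans (cong (λ e → P ^ e % P) (n∸n≡0 α)) (cong (_% P) (sym (𝟙-yes refl (α ≟ α))))
  ... | no β≢α   = trans (∣⇒≋0 (m∣m^n P (m<n⇒0<n∸m (≤∧≢⇒< β≤α β≢α)))) (cong (_% P) (sym (𝟙-no β≢α (β ≟ α))))

  ∣∑-maximal-inverses : ∀ {n} α (x y u V : Vector ℕ n) → 1 ≤ α →
                        (∀ i → x i ≡ P ^ V i * y i) → (∀ i → V i ≤ α) → cofactorSum (λ _ → 1) x ≡ product x →
                        (∀ i → y i * u i ≋ 1) → P ∣ ∑[ i < n ] (𝟙 (V i ≟ α) * u i)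
  ∣∑-maximal-inverses α x y u V 1≤α x≡PᵛY V≤α cofactorSum≡product yu≋1 =
    ∣cofactorSum⇒∣∑ (λ i → 𝟙 (V i ≟ α)) y u yu≋1
      (≋0⇒∣ (trans (cofactorSum-cong-≋ y (λ i → sym (pow-∸≋𝟙 α (V i) (V≤α i)))) (∣⇒≋0 P∣cofactorSum)))
    where
    P∣cofactorSum : P ∣ cofactorSum (λ i → P ^ (α ∸ V i)) y
    P∣cofactorSum = subst (P ∣_) (sym (cofactorSum-strip-powers P α x y V x≡PᵛY V≤α cofactorSum≡product))
                          (∣m⇒∣m*n (product y) (m∣m^n P 1≤α))

  ∣esym⇒∣∑inverses : ∀ t (z w : Vector ℕ (suc t)) → (∀ k → z k * w k ≋ 1) →
                     P ∣ esym t (tabulate z) → P ∣ ∑[ k < suc t ] w k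
  ∣esym⇒∣∑inverses t z w zw≋1 P∣σ =
    subst (P ∣_) (sum-cong-≗ (*-identityˡ ∘ w))
          (∣cofactorSum⇒∣∑ (λ _ → 1) z w zw≋1 (subst (P ∣_) (esym-tabulate-cofactorSum t z) P∣σ))

corollary5 : (p : ℕ) → Prime p →
    (n : ℕ) (x : Fin n → ℕ) →
    (∀ i → 1 ≤ x i) →
    recipSum n x ≡ ℚ.1ℚ →
    ∃ (λ i → p ∣ x i) →
    (t : ℕ) → 2 ≤ t →
    (ι : Fin t → Fin n) → Injective _≡_ _≡_ ι →
    (∀ k → v p (x (ι k)) ≡ maxF n (λ i → v p (x i))) →
    (x′ : Fin t → ℕ) →
    (∀ k → x (ι k) ≡ p ^ maxF n (λ i → v p (x i)) * x′ k) →
    (∀ k → ¬ (p ∣ x′ k)) →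
    p ∣ esym (t ∸ 1) (toList x′) →
    let s = countEq n (λ i → v p (x i)) (maxF n (λ i → v p (x i))) in
    s ≡ t ⊎ t + 2 ≤ s
corollary5 p p-prime n x 1≤x recipSum≡1 _ zero ()
corollary5 p p-prime n x 1≤x recipSum≡1 (i₀ , p∣xᵢ₀) (suc t) _ ι ι-inj Vι≡α x′ xι≡pᵅx′ _ p∣σ =
  subst (λ s → s ≡ suc t ⊎ suc t + 2 ≤ s) (sym (countEq-∑ n V α))
    (∑≡t⊎t+2≤∑ ι ι-inj (λ i → 𝟙 (V i ≟ α)) u (λ k → ≤-reflexive (sym (𝟙-yes (Vι≡α k) (V (ι k) ≟ α))))
               (λ i → inverse-∤ {y i} (nonTrivial⇒≢1 {{prime⇒nonTrivial p-prime}}) (yu≋1 i)) p∣∑maximal p∣∑ι)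
  where
  instance
    p≢0 : NonZero p
    p≢0 = prime⇒nonZero p-prime
  open Modular p
  1<p : 1 < p
  1<p = nonTrivial⇒n>1 p {{prime⇒nonTrivial p-prime}}
  V : Fin n → ℕ
  V i = v p (x i)
  α : ℕ
  α = maxF n V
  y : Fin n → ℕ
  y i = proj₁ (v-split 1<p (1≤x i))
  x≡pᵛy : ∀ i → x i ≡ p ^ V i * y i
  x≡pᵛy i = proj₁ (proj₂ (v-split 1<p (1≤x i)))
  p∤y : ∀ i → ¬ p ∣ y i
  p∤y i = proj₂ (proj₂ (v-split 1<p (1≤x i)))
  u : Fin n → ℕ
  u i = proj₁ (inverse p-prime (p∤y i))
  yu≋1 : ∀ i → y i * u i ≋ 1
  yu≋1 i = proj₂ (inverse p-prime (p∤y i))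
  p∣∑maximal : p ∣ ∑[ i < n ] (𝟙 (V i ≟ α) * u i)
  p∣∑maximal = ∣∑-maximal-inverses α x y u V (≤-trans (∣⇒1≤v 1<p (1≤x i₀) p∣xᵢ₀) (≤-maxF n V i₀)) x≡pᵛy
                 (≤-maxF n V) (recipSum≡1⇒cofactorSum≡product n x 1≤x recipSum≡1) yu≋1
  yι≡x′ : ∀ k → y (ι k) ≡ x′ k
  yι≡x′ k = *-cancelˡ-≡ _ _ (p ^ α) {{m^n≢0 p α}}
              (trans (sym (trans (x≡pᵛy (ι k)) (cong (λ e → p ^ e * y (ι k)) (Vι≡α k)))) (xι≡pᵅx′ k))
  p∣∑ι : p ∣ ∑[ k < suc t ] u (ι k)
  p∣∑ι = ∣esym⇒∣∑inverses t x′ (u ∘ ι) (λ k → subst (λ z → z * u (ι k) ≋ 1) (yι≡x′ k) (yu≋1 (ι k))) p∣σ
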